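{- Let $G$ be a finite simple graph on $t\ge 1$ vertices. Then \[ \frac{1}{|\mathrm{Aut}(G)|\prod_{i=1}^{t}\binom{i-1}{\lfloor (i-1)/2\rfloor}}\le\mathcal{L}(G)\le\frac{1}{|\mathrm{Aut}(G)|}. \]
   Context: Random graph process ("construction"): start with $G_1$, the graph with the single vertex $1$ and no edges. For $t\ge 2$, the graph $G_t$ on vertex set $\{1,\dots,t\}$ is obtained from $G_{t-1}$ (on vertex set $\{1,\dots,t-1\}$) as follows, independently of all earlier choices: choose an integer $k\in\{0,1,\dots,t-1\}$ uniformly at random; then choose a $k$-element subset $S\subseteq\{1,\dots,t-1\}$ uniformly at random among all $\binom{t-1}{k}$ such subsets; then add the new vertex $t$ and the edges $\{s,t\}$ for all $s\in S$. For a finite simple graph $G$ on $t$ vertices, its (graph) likelihood is $\mathcal{L}(G):=\Pr[G_t\cong G]$. $\mathrm{Aut}(G)$ is the full automorphism group of $G$. -}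

module Defs where

open import Data.Nat as ℕ using (ℕ; zero; suc; _*_; _/_)
open import Data.Nat.Combinatorics using (_C_)
open import Data.Integer using (+_)
open import Data.Rational as ℚ using (ℚ; 0ℚ; 1ℚ)
open import Data.Bool using (Bool; true; false; _∧_; _∨_; not; if_then_else_)
import Data.Bool.Properties as BoolP
open import Data.Fin as Fin using (Fin)
import Data.Fin.Properties as FinP
open import Data.Maybe using (Maybe; just; nothing)
import Data.Maybe as Maybe
open import Data.Vec as Vec using (Vec; []; _∷_; lookup)
open import Data.List as List using (List; []; _∷_; concatMap; map; filter; length; foldr; upTo; allFin)
open import Data.Product using (_×_; _,_; proj₁; proj₂)
open import Relation.Binary.PropositionalEquality using (_≡_)
open import Relation.Nullary.Decidable using (isYes)
import Data.Bool.ListAction as BL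
import Data.Nat.ListAction as NL

-- Graphs on vertex set Fin t (vertex i+1 of the paper is Fin index i),
-- given by a Boolean adjacency function.

Adj : ℕ → Set
Adj t = Fin t → Fin t → Bool

record SimpleGraph (t : ℕ) : Set where
  field
    adj    : Adj t
    sym    : ∀ i j → adj i j ≡ adj j i
    irrefl : ∀ i → adj i i ≡ false
open SimpleGraph public

allB : {A : Set} → List A → (A → Bool) → Bool
allB xs p = BL.all p xs

anyB : {A : Set} → List A → (A → Bool) → Bool
anyB xs p = BL.any p xs

_==F_ : ∀ {t} → Fin t → Fin t → Bool
i ==F j = isYes (i Fin.≟ j)

_==B_ : Bool → Bool → Bool
a ==B b = isYes (a BoolP.≟ b)

allVecs : {A : Set} → List A → (m : ℕ) → List (Vec A m)
allVecs xs zero    = [] ∷ []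
allVecs xs (suc m) = concatMap (λ x → map (x ∷_) (allVecs xs m)) xs

allMaps : (t : ℕ) → List (Vec (Fin t) t)
allMaps t = allVecs (allFin t) t

isInjective : ∀ {t} → Vec (Fin t) t → Bool
isInjective {t} σ =
  allB (allFin t) λ i → allB (allFin t) λ j →
    not (lookup σ i ==F lookup σ j) ∨ (i ==F j)

perms : (t : ℕ) → List (Vec (Fin t) t)
perms t = List.filterᵇ isInjective (allMaps t)

isIsoVia : ∀ {t} → Adj t → Adj t → Vec (Fin t) t → Bool
isIsoVia {t} H G σ =
  allB (allFin t) λ i → allB (allFin t) λ j →
    G (lookup σ i) (lookup σ j) ==B H i j

isomorphic : ∀ {t} → Adj t → Adj t → Bool
isomorphic {t} H G = anyB (perms t) (isIsoVia H G)

autList : ∀ {t} → SimpleGraph t → List (Vec (Fin t) t)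
autList {t} G =
  List.filterᵇ (isIsoVia (adj G) (adj G)) (perms t)

autCount : ∀ {t} → SimpleGraph t → ℕ
autCount G = length (autList G)

-- 1/m for m ≥ 1 (the value at 0 is never used in a meaningful place)
inv : ℕ → ℚ
inv zero    = 0ℚ
inv (suc m) = + 1 ℚ./ suc m

sumℚ : List ℚ → ℚ
sumℚ = foldr ℚ._+_ 0ℚ

-- The random graph process as an explicit finite distribution
-- (list of outcomes with their probabilities).

-- The new vertex is the last element of Fin (suc m); old vertices are
-- the first m elements.
isOld : ∀ {m} → Fin (suc m) → Maybe (Fin m)
isOld {zero}  Fin.zero    = nothing
isOld {suc m} Fin.zero    = just Fin.zero
isOld {suc m} (Fin.suc i) = Maybe.map Fin.suc (isOld i)

extend : ∀ {m} → Adj m → Vec Bool m → Adj (suc m)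
extend H S i j with isOld i | isOld j
... | just a  | just b  = H a b
... | just a  | nothing = lookup S a
... | nothing | just b  = lookup S b
... | nothing | nothing = false

countTrue : ∀ {m} → Vec Bool m → ℕ
countTrue []          = 0
countTrue (b ∷ bs)    = (if b then 1 else 0) ℕ.+ countTrue bs

-- all k-element subsets of Fin m (as characteristic vectors)
subsetsOfSize : (m k : ℕ) → List (Vec Bool m)
subsetsOfSize m k =
  List.filterᵇ (λ S → isYes (countTrue S ℕ.≟ k)) (allVecs (true ∷ false ∷ []) m)

-- one step: from G_m to G_{m+1}; k uniform in {0,…,m}, then S uniform
-- among the (m choose k) k-subsets.
step : ∀ {m} → List (Adj m × ℚ) → List (Adj (suc m) × ℚ)
step {m} d =
  concatMap (λ { (H , w) →
    concatMap (λ k →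
      map (λ S → extend H S , w ℚ.* (inv (suc m) ℚ.* inv (m C k)))
          (subsetsOfSize m k))
      (upTo (suc m)) }) d

-- distribution of G_{n+1}
process : (n : ℕ) → List (Adj (suc n) × ℚ)
process zero    = ((λ _ _ → false) , 1ℚ) ∷ []
process (suc n) = step (process n)

likelihood : ∀ {n} → SimpleGraph (suc n) → ℚ
likelihood {n} G =
  sumℚ (map (λ { (H , w) → if isomorphic H (adj G) then w else 0ℚ })
            (process n))

binomProd : ℕ → ℕ
binomProd t = NL.product (map (λ m → m C (m / 2)) (upTo t))

-- For a labelled graph K on vertices 1, …, t the process produces exactly K with probability
-- ∏_{m<t} 1 / ((m+1) · C(m, d_m)), where d_m is the number of neighbours of vertex m+1 among 1, …, m.
-- Since 1 ≤ C(m, d_m) ≤ C(m, ⌊m/2⌋), this probability lies between 1/(t! ∏_m C(m, ⌊m/2⌋)) and 1/t!.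
-- As σ runs over the t! permutations, the relabellings G∘σ run over the isomorphism class of G, each labelled
-- graph being hit exactly |Aut(G)| times; hence |Aut(G)| · L(G) = Σ_σ Pr[G_t = G∘σ], and summing the t!
-- bounds gives 1/∏_m C(m, ⌊m/2⌋) ≤ |Aut(G)| · L(G) ≤ 1.

module Submission where

open import Data.Bool using (Bool; true; false; _∧_; _∨_; not; if_then_else_; T)
import Data.Bool.Properties as BoolP
open import Data.Empty using (⊥; ⊥-elim)
open import Data.Fin as Fin using (Fin)
import Data.Fin.Properties as FinP
open import Data.Integer as ℤ using ()
import Data.Integer.Properties as ℤP
import Data.Integer.Solver as ℤSolver
open import Data.List as List using (List; []; _∷_; map; _++_; concatMap; length; filterᵇ; allFin; upTo)
import Data.List.Properties as ListP
open import Data.List.Membership.Propositional using (_∈_; find)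
open import Data.List.Membership.Propositional.Properties using (∈-allFin; ∈-filter⁻)
import Data.List.Relation.Unary.All as All
open import Data.List.Relation.Unary.All.Properties using (all⁺; all⁻; tabulate⁺)
open import Data.List.Relation.Unary.Any.Properties using (any⁻)
open import Data.Maybe using (just; nothing)
import Data.Maybe as Maybe
open import Data.Nat as ℕ using (ℕ; zero; suc; _∸_; _!; z≤n; s≤s)
import Data.Nat.Properties as ℕP
open import Data.Nat.Combinatorics using (_C_; nCk+nC[k+1]≡[n+1]C[k+1]; nCk≡nC[n∸k])
open import Data.Nat.Combinatorics.Base using (_P′_)
open import Data.Nat.Combinatorics.Specification using (nP′n≡n!)
open import Data.Nat.DivMod using (m/n*n≤m; m≡m%n+[m/n]*n; m%n<n; m/n≤m)
import Data.Nat.ListAction as ℕL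
open import Data.Nat.ListAction.Properties using (product-++)
open import Data.Product using (_×_; _,_; proj₁; proj₂; ∃)
open import Data.Rational as ℚ using (ℚ; 0ℚ; 1ℚ; _+_; _*_; _≤_)
import Data.Rational.Properties as ℚP
open import Algebra.Properties.Group ℚP.+-0-group using (∙-cancelʳ)
import Data.Rational.Solver as ℚSolver
open import Data.Rational.Unnormalised as ℚᵘ using (mkℚᵘ; *≡*; *≤*)
import Data.Rational.Unnormalised.Properties as ℚᵘP
open import Data.Sum using (_⊎_; inj₁; inj₂)
open import Data.Unit using (tt)
open import Data.Vec as Vec using (Vec; []; _∷_; lookup)
import Data.Vec.Properties as VecP
open import Function.Base using (_∘_)
open import Function.Bundles using (mk⇔; module Equivalence)
open import Function.Definitions using (Injective)
open import Relation.Binary.Definitions using (DecidableEquality)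
open import Relation.Binary.PropositionalEquality
open import Relation.Nullary.Decidable using (yes; no; does; does-⇔; isYes; isYes≗does; T?; toWitness; fromWitness)
open import Defs hiding (sym)

fromℕ : ℕ → ℚ
fromℕ n = ℤ.+ n ℚ./ 1

toℚᵘ-fromℕ : ∀ n → ℚ.toℚᵘ (fromℕ n) ℚᵘ.≃ mkℚᵘ (ℤ.+ n) 0
toℚᵘ-fromℕ n = ℚP.toℚᵘ-fromℚᵘ (mkℚᵘ (ℤ.+ n) 0)

toℚᵘ-inv : ∀ n → ℚ.toℚᵘ (inv (suc n)) ℚᵘ.≃ mkℚᵘ (ℤ.+ 1) n
toℚᵘ-inv n = ℚP.toℚᵘ-fromℚᵘ (mkℚᵘ (ℤ.+ 1) n)

fromℕ-suc : ∀ n → fromℕ (suc n) ≡ 1ℚ + fromℕ n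
fromℕ-suc n = ℚP.toℚᵘ-injective (begin
  ℚ.toℚᵘ (fromℕ (suc n))
    ≈⟨ toℚᵘ-fromℕ (suc n) ⟩
  mkℚᵘ (ℤ.+ suc n) 0
    ≈⟨ *≡* (solve 1 (λ x → (one :+ x) :* one := (one :* one :+ x :* one) :* one) refl (ℤ.+ n)) ⟩
  mkℚᵘ (ℤ.+ 1) 0 ℚᵘ.+ mkℚᵘ (ℤ.+ n) 0
    ≈⟨ ℚᵘP.+-congʳ (mkℚᵘ (ℤ.+ 1) 0) (ℚᵘP.≃-sym (toℚᵘ-fromℕ n)) ⟩
  ℚ.toℚᵘ 1ℚ ℚᵘ.+ ℚ.toℚᵘ (fromℕ n)
    ≈⟨ ℚᵘP.≃-sym (ℚP.toℚᵘ-homo-+ 1ℚ (fromℕ n)) ⟩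
  ℚ.toℚᵘ (1ℚ + fromℕ n)
    ∎)
  where
  open ℚᵘP.≃-Reasoning
  open ℤSolver.+-*-Solver
  one : Polynomial 1
  one = con (ℤ.+ 1)

fromℕ-+ : ∀ a b → fromℕ (a ℕ.+ b) ≡ fromℕ a + fromℕ b
fromℕ-+ zero    b = sym (ℚP.+-identityˡ (fromℕ b))
fromℕ-+ (suc a) b = begin
  fromℕ (suc (a ℕ.+ b))         ≡⟨ fromℕ-suc (a ℕ.+ b) ⟩
  1ℚ + fromℕ (a ℕ.+ b)          ≡⟨ cong (1ℚ +_) (fromℕ-+ a b) ⟩
  1ℚ + (fromℕ a + fromℕ b)      ≡⟨ ℚP.+-assoc 1ℚ (fromℕ a) (fromℕ b) ⟨
  (1ℚ + fromℕ a) + fromℕ b      ≡⟨ cong (_+ fromℕ b) (fromℕ-suc a) ⟨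
  fromℕ (suc a) + fromℕ b       ∎
  where open ≡-Reasoning

fromℕ-* : ∀ a b → fromℕ (a ℕ.* b) ≡ fromℕ a * fromℕ b
fromℕ-* zero    b = sym (ℚP.*-zeroˡ (fromℕ b))
fromℕ-* (suc a) b = begin
  fromℕ (b ℕ.+ a ℕ.* b)              ≡⟨ fromℕ-+ b (a ℕ.* b) ⟩
  fromℕ b + fromℕ (a ℕ.* b)          ≡⟨ cong (fromℕ b +_) (fromℕ-* a b) ⟩
  fromℕ b + fromℕ a * fromℕ b        ≡⟨ cong (_+ fromℕ a * fromℕ b) (ℚP.*-identityˡ (fromℕ b)) ⟨
  1ℚ * fromℕ b + fromℕ a * fromℕ b   ≡⟨ ℚP.*-distribʳ-+ (fromℕ b) 1ℚ (fromℕ a) ⟨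
  (1ℚ + fromℕ a) * fromℕ b           ≡⟨ cong (_* fromℕ b) (fromℕ-suc a) ⟨
  fromℕ (suc a) * fromℕ b            ∎
  where open ≡-Reasoning

inv-inverseˡ : ∀ n → inv (suc n) * fromℕ (suc n) ≡ 1ℚ
inv-inverseˡ n = ℚP.toℚᵘ-injective (begin
  ℚ.toℚᵘ (inv (suc n) * fromℕ (suc n))
    ≈⟨ ℚP.toℚᵘ-homo-* (inv (suc n)) (fromℕ (suc n)) ⟩
  ℚ.toℚᵘ (inv (suc n)) ℚᵘ.* ℚ.toℚᵘ (fromℕ (suc n))
    ≈⟨ ℚᵘP.*-cong (toℚᵘ-inv n) (toℚᵘ-fromℕ (suc n)) ⟩
  mkℚᵘ (ℤ.+ 1) n ℚᵘ.* mkℚᵘ (ℤ.+ suc n) 0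
    ≈⟨ *≡* (solve 1 (λ x → (one :* (one :+ x)) :* one := one :* ((one :+ x) :* one)) refl (ℤ.+ n)) ⟩
  ℚ.toℚᵘ 1ℚ
    ∎)
  where
  open ℚᵘP.≃-Reasoning
  open ℤSolver.+-*-Solver
  one : Polynomial 1
  one = con (ℤ.+ 1)

fromℕ-inverseˡ : ∀ {n} → 1 ℕ.≤ n → fromℕ n * inv n ≡ 1ℚ
fromℕ-inverseˡ {suc n} _ = trans (ℚP.*-comm (fromℕ (suc n)) (inv (suc n))) (inv-inverseˡ n)

inv-* : ∀ a b → inv (a ℕ.* b) ≡ inv a * inv b
inv-* zero    b = sym (ℚP.*-zeroˡ (inv b))
inv-* (suc a) zero rewrite ℕP.*-zeroʳ a = sym (ℚP.*-zeroʳ (inv (suc a)))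
inv-* (suc a) (suc b) = begin
  X                                                    ≡⟨ ℚP.*-identityʳ X ⟨
  X * 1ℚ                                               ≡⟨ cong (X *_) ones ⟨
  X * ((Y * fromℕ (suc a)) * (Z * fromℕ (suc b)))      ≡⟨ solve 5 (λ x y p z q → x :* ((y :* p) :* (z :* q))
                                                                  := (x :* (p :* q)) :* (y :* z))
                                                                refl X Y (fromℕ (suc a)) Z (fromℕ (suc b)) ⟩
  (X * (fromℕ (suc a) * fromℕ (suc b))) * (Y * Z)      ≡⟨ cong (λ w → (X * w) * (Y * Z)) (fromℕ-* (suc a) (suc b)) ⟨
  (X * fromℕ (suc a ℕ.* suc b)) * (Y * Z)              ≡⟨ cong (_* (Y * Z)) (inv-inverseˡ (b ℕ.+ a ℕ.* suc b)) ⟩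
  1ℚ * (Y * Z)                                         ≡⟨ ℚP.*-identityˡ (Y * Z) ⟩
  Y * Z                                                ∎
  where
  open ≡-Reasoning
  open ℚSolver.+-*-Solver
  X Y Z : ℚ
  X = inv (suc a ℕ.* suc b)
  Y = inv (suc a)
  Z = inv (suc b)
  ones : (Y * fromℕ (suc a)) * (Z * fromℕ (suc b)) ≡ 1ℚ
  ones = cong₂ _*_ (inv-inverseˡ a) (inv-inverseˡ b)

inv-nonNeg : ∀ n → 0ℚ ≤ inv n
inv-nonNeg zero    = ℚP.≤-refl
inv-nonNeg (suc n) = ℚP.toℚᵘ-cancel-≤ (ℚᵘP.≤-respʳ-≃ (ℚᵘP.≃-sym (toℚᵘ-inv n)) (*≤* (ℤ.+≤+ z≤n)))

inv-antimono : ∀ {m n} → 1 ℕ.≤ m → m ℕ.≤ n → inv n ≤ inv m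
inv-antimono {suc m} {suc n} _ m≤n = ℚP.toℚᵘ-cancel-≤
  (ℚᵘP.≤-respʳ-≃ (ℚᵘP.≃-sym (toℚᵘ-inv m)) (ℚᵘP.≤-respˡ-≃ (ℚᵘP.≃-sym (toℚᵘ-inv n))
    (*≤* (subst₂ ℤ._≤_ (sym (ℤP.*-identityˡ _)) (sym (ℤP.*-identityˡ _)) (ℤ.+≤+ m≤n)))))

inv≤1 : ∀ {n} → 1 ℕ.≤ n → inv n ≤ 1ℚ
inv≤1 1≤n = inv-antimono ℕP.≤-refl 1≤n

*-mono-≤-nonNeg : ∀ {p p′ q q′} → 0ℚ ≤ p → 0ℚ ≤ q′ → p ≤ p′ → q ≤ q′ → p * q ≤ p′ * q′
*-mono-≤-nonNeg {p} {p′} {q} {q′} 0≤p 0≤q′ p≤p′ q≤q′ = ℚP.≤-trans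
  (ℚP.*-monoˡ-≤-nonNeg p {{ℚ.nonNegative 0≤p}} q≤q′)
  (ℚP.*-monoʳ-≤-nonNeg q′ {{ℚ.nonNegative 0≤q′}} p≤p′)

private
  variable
    A B : Set

∑ : List A → (A → ℚ) → ℚ
∑ []       f = 0ℚ
∑ (x ∷ xs) f = f x + ∑ xs f

⟦_⟧ : Bool → ℚ
⟦ b ⟧ = if b then 1ℚ else 0ℚ

sumℚ-map : ∀ (xs : List A) f → sumℚ (map f xs) ≡ ∑ xs f
sumℚ-map []       f = refl
sumℚ-map (x ∷ xs) f = cong (f x +_) (sumℚ-map xs f)

∑-cong : ∀ (xs : List A) {f g : A → ℚ} → (∀ x → f x ≡ g x) → ∑ xs f ≡ ∑ xs g
∑-cong []       f≗g = refl
∑-cong (x ∷ xs) f≗g = cong₂ _+_ (f≗g x) (∑-cong xs f≗g)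

∑-++ : ∀ (xs ys : List A) f → ∑ (xs ++ ys) f ≡ ∑ xs f + ∑ ys f
∑-++ []       ys f = sym (ℚP.+-identityˡ _)
∑-++ (x ∷ xs) ys f = trans (cong (f x +_) (∑-++ xs ys f)) (sym (ℚP.+-assoc (f x) _ _))

∑-map : ∀ (xs : List B) (g : B → A) f → ∑ (map g xs) f ≡ ∑ xs (λ x → f (g x))
∑-map []       g f = refl
∑-map (x ∷ xs) g f = cong (f (g x) +_) (∑-map xs g f)

∑-concatMap : ∀ (xs : List B) (g : B → List A) f →
              ∑ (concatMap g xs) f ≡ ∑ xs (λ x → ∑ (g x) f)
∑-concatMap []       g f = refl
∑-concatMap (x ∷ xs) g f =
  trans (∑-++ (g x) (concatMap g xs) f) (cong (∑ (g x) f +_) (∑-concatMap xs g f))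

∑-zero : ∀ (xs : List A) → ∑ xs (λ _ → 0ℚ) ≡ 0ℚ
∑-zero []       = refl
∑-zero (x ∷ xs) = trans (ℚP.+-identityˡ _) (∑-zero xs)

∑-+ : ∀ (xs : List A) f g → ∑ xs (λ x → f x + g x) ≡ ∑ xs f + ∑ xs g
∑-+ []       f g = sym (ℚP.+-identityˡ 0ℚ)
∑-+ (x ∷ xs) f g = trans (cong (f x + g x +_) (∑-+ xs f g))
  (solve 4 (λ a b c d → (a :+ b) :+ (c :+ d) := (a :+ c) :+ (b :+ d)) refl (f x) (g x) (∑ xs f) (∑ xs g))
  where open ℚSolver.+-*-Solver

∑-*ˡ : ∀ (xs : List A) c f → ∑ xs (λ x → c * f x) ≡ c * ∑ xs f
∑-*ˡ []       c f = sym (ℚP.*-zeroʳ c)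
∑-*ˡ (x ∷ xs) c f = trans (cong (c * f x +_) (∑-*ˡ xs c f)) (sym (ℚP.*-distribˡ-+ c (f x) (∑ xs f)))

∑-*ʳ : ∀ (xs : List A) c f → ∑ xs (λ x → f x * c) ≡ ∑ xs f * c
∑-*ʳ xs c f = trans (∑-cong xs (λ x → ℚP.*-comm (f x) c)) (trans (∑-*ˡ xs c f) (ℚP.*-comm c _))

∑-swap : ∀ (xs : List A) (ys : List B) (f : A → B → ℚ) →
         ∑ xs (λ x → ∑ ys (f x)) ≡ ∑ ys (λ y → ∑ xs (λ x → f x y))
∑-swap []       ys f = sym (∑-zero ys)
∑-swap (x ∷ xs) ys f =
  trans (cong (∑ ys (f x) +_) (∑-swap xs ys f)) (sym (∑-+ ys (f x) (λ y → ∑ xs (λ x′ → f x′ y))))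

∑-filterᵇ : ∀ (xs : List A) p f → ∑ (filterᵇ p xs) f ≡ ∑ xs (λ x → ⟦ p x ⟧ * f x)
∑-filterᵇ []       p f = refl
∑-filterᵇ (x ∷ xs) p f with p x
... | true  = cong₂ _+_ (sym (ℚP.*-identityˡ (f x))) (∑-filterᵇ xs p f)
... | false = trans (∑-filterᵇ xs p f) (sym (trans (cong (_+ _) (ℚP.*-zeroˡ (f x))) (ℚP.+-identityˡ _)))

∑-const : ∀ (xs : List A) c → ∑ xs (λ _ → c) ≡ fromℕ (length xs) * c
∑-const []       c = sym (ℚP.*-zeroˡ c)
∑-const (x ∷ xs) c = begin
  c + ∑ xs (λ _ → c)                ≡⟨ cong₂ _+_ (sym (ℚP.*-identityˡ c)) (∑-const xs c) ⟩
  1ℚ * c + fromℕ (length xs) * c    ≡⟨ ℚP.*-distribʳ-+ c 1ℚ (fromℕ (length xs)) ⟨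
  (1ℚ + fromℕ (length xs)) * c      ≡⟨ cong (_* c) (fromℕ-suc (length xs)) ⟨
  fromℕ (suc (length xs)) * c       ∎
  where open ≡-Reasoning

∑-mono-≤ : ∀ (xs : List A) {f g : A → ℚ} → (∀ x → f x ≤ g x) → ∑ xs f ≤ ∑ xs g
∑-mono-≤ []       f≤g = ℚP.≤-refl
∑-mono-≤ (x ∷ xs) f≤g = ℚP.+-mono-≤ (f≤g x) (∑-mono-≤ xs f≤g)

⟦∧⟧ : ∀ a b → ⟦ a ∧ b ⟧ ≡ ⟦ a ⟧ * ⟦ b ⟧
⟦∧⟧ true  b = sym (ℚP.*-identityˡ ⟦ b ⟧)
⟦∧⟧ false b = sym (ℚP.*-zeroˡ ⟦ b ⟧)

T-ext : ∀ {a b} → (T a → T b) → (T b → T a) → a ≡ b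
T-ext {true}  {true}  _ _ = refl
T-ext {true}  {false} f _ = ⊥-elim (f tt)
T-ext {false} {true}  _ g = ⊥-elim (g tt)
T-ext {false} {false} _ _ = refl

T-not⇒¬T : ∀ {b} → T (not b) → T b → ⊥
T-not⇒¬T {false} _ ()

T-allFin-elim : ∀ {t} (p : Fin t → Bool) → T (allB (allFin t) p) → ∀ i → T (p i)
T-allFin-elim {t} p h i = All.lookup (all⁺ p (allFin t) h) (∈-allFin i)

T-allFin-intro : ∀ {t} (p : Fin t → Bool) → (∀ i → T (p i)) → T (allB (allFin t) p)
T-allFin-intro p h = all⁻ p (tabulate⁺ h)

multiplicity : DecidableEquality A → List A → A → ℚ
multiplicity _≟_ xs x = ∑ xs (λ y → ⟦ does (y ≟ x) ⟧)

Enumerates : DecidableEquality A → List A → Set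
Enumerates _≟_ xs = ∀ x → multiplicity _≟_ xs x ≡ 1ℚ

∑-pick : ∀ (_≟_ : DecidableEquality A) xs x → multiplicity _≟_ xs x ≡ 1ℚ → (g : A → ℚ) →
         ∑ xs (λ y → ⟦ does (y ≟ x) ⟧ * g y) ≡ g x
∑-pick _≟_ xs x once g = begin
  ∑ xs (λ y → ⟦ does (y ≟ x) ⟧ * g y)   ≡⟨ ∑-cong xs pointwise ⟩
  ∑ xs (λ y → ⟦ does (y ≟ x) ⟧ * g x)   ≡⟨ ∑-*ʳ xs (g x) _ ⟩
  multiplicity _≟_ xs x * g x           ≡⟨ cong (_* g x) once ⟩
  1ℚ * g x                              ≡⟨ ℚP.*-identityˡ (g x) ⟩
  g x                                   ∎
  where
  open ≡-Reasoning
  pointwise : ∀ y → ⟦ does (y ≟ x) ⟧ * g y ≡ ⟦ does (y ≟ x) ⟧ * g x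
  pointwise y with y ≟ x
  ... | yes refl = refl
  ... | no _     = trans (ℚP.*-zeroˡ (g y)) (sym (ℚP.*-zeroˡ (g x)))

∑-reindex : ∀ (_≟_ : DecidableEquality A) {xs} → Enumerates _≟_ xs →
            (φ ψ : A → A) → (∀ x → ψ (φ x) ≡ x) → (∀ y → φ (ψ y) ≡ y) →
            (f : A → ℚ) → ∑ xs (λ x → f (φ x)) ≡ ∑ xs f
∑-reindex _≟_ {xs} enum φ ψ ψφ φψ f = begin
  ∑ xs (λ x → f (φ x))                                 ≡⟨ ∑-cong xs (λ x → ∑-pick _≟_ xs (φ x) (enum (φ x)) f) ⟨
  ∑ xs (λ x → ∑ xs (λ y → ⟦ does (y ≟ φ x) ⟧ * f y))   ≡⟨ ∑-swap xs xs _ ⟩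
  ∑ xs (λ y → ∑ xs (λ x → ⟦ does (y ≟ φ x) ⟧ * f y))   ≡⟨ ∑-cong xs (λ y → ∑-cong xs (λ x →
                                                            cong (λ b → ⟦ b ⟧ * f y) (transpose x y))) ⟩
  ∑ xs (λ y → ∑ xs (λ x → ⟦ does (x ≟ ψ y) ⟧ * f y))   ≡⟨ ∑-cong xs (λ y → ∑-*ʳ xs (f y) _) ⟩
  ∑ xs (λ y → multiplicity _≟_ xs (ψ y) * f y)         ≡⟨ ∑-cong xs (λ y → cong (_* f y) (enum (ψ y))) ⟩
  ∑ xs (λ y → 1ℚ * f y)                                ≡⟨ ∑-cong xs (λ y → ℚP.*-identityˡ (f y)) ⟩
  ∑ xs f                                               ∎
  where
  open ≡-Reasoning
  transpose : ∀ x y → does (y ≟ φ x) ≡ does (x ≟ ψ y)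
  transpose x y = does-⇔ (mk⇔ (λ eq → trans (sym (ψφ x)) (cong ψ (sym eq)))
                              (λ eq → trans (sym (φψ y)) (cong φ (sym eq))))
                         (y ≟ φ x) (x ≟ ψ y)

-- The enumeration proofs rely on `does` computing through the standard deciders: does (suc y ≟ suc x)
-- reduces to does (y ≟ x), does (suc y ≟ zero) to false, and on vectors does (x ∷ u ≟ y ∷ v) to
-- does (x ≟ y) ∧ does (u ≟ v).
∑-allFin-suc : ∀ n (h : Fin (suc n) → ℚ) → ∑ (allFin (suc n)) h ≡ h Fin.zero + ∑ (allFin n) (λ i → h (Fin.suc i))
∑-allFin-suc n h = cong (h Fin.zero +_)
  (trans (cong (λ l → ∑ l h) (sym (ListP.map-tabulate (λ i → i) Fin.suc))) (∑-map (allFin n) Fin.suc h))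

allFin-enumerates : ∀ n → Enumerates FinP._≟_ (allFin n)
allFin-enumerates (suc n) Fin.zero =
  trans (∑-allFin-suc n (λ y → ⟦ does (y FinP.≟ Fin.zero) ⟧)) (trans (cong (1ℚ +_) (∑-zero (allFin n))) (ℚP.+-identityʳ 1ℚ))
allFin-enumerates (suc n) (Fin.suc x) =
  trans (∑-allFin-suc n (λ y → ⟦ does (y FinP.≟ Fin.suc x) ⟧)) (trans (ℚP.+-identityˡ _) (allFin-enumerates n x))

∑-upTo-suc : ∀ n (h : ℕ → ℚ) → ∑ (upTo (suc n)) h ≡ h 0 + ∑ (upTo n) (λ k → h (suc k))
∑-upTo-suc n h = cong (h 0 +_)
  (trans (cong (λ l → ∑ l h) (sym (ListP.map-upTo suc n))) (∑-map (upTo n) suc h))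

upTo-multiplicity : ∀ {n x} → x ℕ.< n → multiplicity ℕP._≟_ (upTo n) x ≡ 1ℚ
upTo-multiplicity {suc n} {zero}  _ =
  trans (∑-upTo-suc n (λ k → ⟦ does (k ℕP.≟ 0) ⟧)) (trans (cong (1ℚ +_) (∑-zero (upTo n))) (ℚP.+-identityʳ 1ℚ))
upTo-multiplicity {suc n} {suc x} (s≤s x<n) =
  trans (∑-upTo-suc n (λ k → ⟦ does (k ℕP.≟ suc x) ⟧)) (trans (ℚP.+-identityˡ _) (upTo-multiplicity x<n))

bools : List Bool
bools = true ∷ false ∷ []

bools-enumerates : Enumerates BoolP._≟_ bools
bools-enumerates true  = refl
bools-enumerates false = refl

allVecs-enumerates : ∀ {A : Set} {_≟_ : DecidableEquality A} {xs} → Enumerates _≟_ xs →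
                     ∀ m → Enumerates (VecP.≡-dec _≟_) (allVecs xs m)
allVecs-enumerates enum zero    [] = ℚP.+-identityʳ 1ℚ
allVecs-enumerates {A} {_≟_} {xs} enum (suc m) (a ∷ v) = begin
  ∑ (concatMap (λ x → map (x ∷_) V) xs) (λ u → ⟦ does (VecP.≡-dec _≟_ u (a ∷ v)) ⟧)
    ≡⟨ ∑-concatMap xs _ _ ⟩
  ∑ xs (λ x → ∑ (map (x ∷_) V) (λ u → ⟦ does (VecP.≡-dec _≟_ u (a ∷ v)) ⟧))
    ≡⟨ ∑-cong xs (λ x → ∑-map V (x ∷_) _) ⟩
  ∑ xs (λ x → ∑ V (λ u → ⟦ does (x ≟ a) ∧ does (VecP.≡-dec _≟_ u v) ⟧))
    ≡⟨ ∑-cong xs (λ x → trans (∑-cong V (λ u → ⟦∧⟧ (does (x ≟ a)) _))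
                              (∑-*ˡ V ⟦ does (x ≟ a) ⟧ (λ u → ⟦ does (VecP.≡-dec _≟_ u v) ⟧))) ⟩
  ∑ xs (λ x → ⟦ does (x ≟ a) ⟧ * multiplicity (VecP.≡-dec _≟_) V v)
    ≡⟨ ∑-cong xs (λ x → cong (⟦ does (x ≟ a) ⟧ *_) (allVecs-enumerates enum m v)) ⟩
  ∑ xs (λ x → ⟦ does (x ≟ a) ⟧ * 1ℚ)
    ≡⟨ ∑-cong xs (λ x → ℚP.*-identityʳ _) ⟩
  multiplicity _≟_ xs a
    ≡⟨ enum a ⟩
  1ℚ
    ∎
  where
  open ≡-Reasoning
  V : List (Vec A m)
  V = allVecs xs m

-- Counting permutations

_∈ᵇ_ : ∀ {t m} → Fin t → Vec (Fin t) m → Bool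
x ∈ᵇ []      = false
x ∈ᵇ (y ∷ v) = does (x FinP.≟ y) ∨ x ∈ᵇ v

-- An inductive form of isInjective (see isInjective≡distinct), suited to counting injections.
distinct : ∀ {t m} → Vec (Fin t) m → Bool
distinct []      = true
distinct (x ∷ v) = not (x ∈ᵇ v) ∧ distinct v

∑-∈ᵇ : ∀ {t m} (v : Vec (Fin t) m) → T (distinct v) → ∑ (allFin t) (λ x → ⟦ x ∈ᵇ v ⟧) ≡ fromℕ m
∑-∈ᵇ {t} []                  _  = ∑-zero (allFin t)
∑-∈ᵇ {t} {suc m} (y ∷ v) y∉v∧v = begin
  ∑ (allFin t) (λ x → ⟦ does (x FinP.≟ y) ∨ x ∈ᵇ v ⟧)               ≡⟨ ∑-cong (allFin t) split ⟩
  ∑ (allFin t) (λ x → ⟦ does (x FinP.≟ y) ⟧ + ⟦ x ∈ᵇ v ⟧)           ≡⟨ ∑-+ (allFin t) _ _ ⟩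
  multiplicity FinP._≟_ (allFin t) y + ∑ (allFin t) (λ x → ⟦ x ∈ᵇ v ⟧)
    ≡⟨ cong₂ _+_ (allFin-enumerates t y) (∑-∈ᵇ v (proj₂ (Equivalence.to BoolP.T-∧ y∉v∧v))) ⟩
  1ℚ + fromℕ m                                                        ≡⟨ fromℕ-suc m ⟨
  fromℕ (suc m)                                                       ∎
  where
  open ≡-Reasoning
  split : ∀ x → ⟦ does (x FinP.≟ y) ∨ x ∈ᵇ v ⟧ ≡ ⟦ does (x FinP.≟ y) ⟧ + ⟦ x ∈ᵇ v ⟧
  split x with x FinP.≟ y
  ... | no _     = sym (ℚP.+-identityˡ _)
  ... | yes refl with x ∈ᵇ v | proj₁ (Equivalence.to (BoolP.T-∧ {not (x ∈ᵇ v)}) y∉v∧v)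
  ...   | false | _  = refl
  ...   | true  | ()

⟦not⟧+⟦⟧ : ∀ b → ⟦ not b ⟧ + ⟦ b ⟧ ≡ 1ℚ
⟦not⟧+⟦⟧ true  = refl
⟦not⟧+⟦⟧ false = refl

∑-∉ᵇ : ∀ {t m} (v : Vec (Fin t) m) → m ℕ.≤ t → T (distinct v) →
       ∑ (allFin t) (λ x → ⟦ not (x ∈ᵇ v) ⟧) ≡ fromℕ (t ∸ m)
∑-∉ᵇ {t} {m} v m≤t distinct-v = ∙-cancelʳ (fromℕ m) _ _ (begin
  ∑ (allFin t) (λ x → ⟦ not (x ∈ᵇ v) ⟧) + fromℕ m
    ≡⟨ cong (∑ (allFin t) (λ x → ⟦ not (x ∈ᵇ v) ⟧) +_) (∑-∈ᵇ v distinct-v) ⟨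
  ∑ (allFin t) (λ x → ⟦ not (x ∈ᵇ v) ⟧) + ∑ (allFin t) (λ x → ⟦ x ∈ᵇ v ⟧)
    ≡⟨ ∑-+ (allFin t) _ _ ⟨
  ∑ (allFin t) (λ x → ⟦ not (x ∈ᵇ v) ⟧ + ⟦ x ∈ᵇ v ⟧)
    ≡⟨ ∑-cong (allFin t) (λ x → ⟦not⟧+⟦⟧ (x ∈ᵇ v)) ⟩
  ∑ (allFin t) (λ _ → 1ℚ)
    ≡⟨ ∑-const (allFin t) 1ℚ ⟩
  fromℕ (length (allFin t)) * 1ℚ
    ≡⟨ ℚP.*-identityʳ _ ⟩
  fromℕ (length (allFin t))
    ≡⟨ cong fromℕ (ListP.length-tabulate {n = t} (λ i → i)) ⟩
  fromℕ t
    ≡⟨ cong fromℕ (ℕP.m∸n+n≡m m≤t) ⟨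
  fromℕ (t ∸ m ℕ.+ m)
    ≡⟨ fromℕ-+ (t ∸ m) m ⟩
  fromℕ (t ∸ m) + fromℕ m
    ∎)
  where open ≡-Reasoning

∑-distinct : ∀ t m → m ℕ.≤ t → ∑ (allVecs (allFin t) m) (λ v → ⟦ distinct v ⟧) ≡ fromℕ (t P′ m)
∑-distinct t zero    _    = ℚP.+-identityʳ 1ℚ
∑-distinct t (suc m) m<t = begin
  ∑ (concatMap (λ x → map (x ∷_) V) (allFin t)) (λ v → ⟦ distinct v ⟧)
    ≡⟨ ∑-concatMap (allFin t) _ _ ⟩
  ∑ (allFin t) (λ x → ∑ (map (x ∷_) V) (λ v → ⟦ distinct v ⟧))
    ≡⟨ ∑-cong (allFin t) (λ x → ∑-map V (x ∷_) _) ⟩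
  ∑ (allFin t) (λ x → ∑ V (λ v → ⟦ not (x ∈ᵇ v) ∧ distinct v ⟧))
    ≡⟨ ∑-cong (allFin t) (λ x → ∑-cong V (λ v → ⟦∧⟧ (not (x ∈ᵇ v)) (distinct v))) ⟩
  ∑ (allFin t) (λ x → ∑ V (λ v → ⟦ not (x ∈ᵇ v) ⟧ * ⟦ distinct v ⟧))
    ≡⟨ ∑-swap (allFin t) V _ ⟩
  ∑ V (λ v → ∑ (allFin t) (λ x → ⟦ not (x ∈ᵇ v) ⟧ * ⟦ distinct v ⟧))
    ≡⟨ ∑-cong V (λ v → ∑-*ʳ (allFin t) ⟦ distinct v ⟧ (λ x → ⟦ not (x ∈ᵇ v) ⟧)) ⟩
  ∑ V (λ v → ∑ (allFin t) (λ x → ⟦ not (x ∈ᵇ v) ⟧) * ⟦ distinct v ⟧)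
    ≡⟨ ∑-cong V extensions ⟩
  ∑ V (λ v → fromℕ (t ∸ m) * ⟦ distinct v ⟧)
    ≡⟨ ∑-*ˡ V (fromℕ (t ∸ m)) _ ⟩
  fromℕ (t ∸ m) * ∑ V (λ v → ⟦ distinct v ⟧)
    ≡⟨ cong (fromℕ (t ∸ m) *_) (∑-distinct t m (ℕP.<⇒≤ m<t)) ⟩
  fromℕ (t ∸ m) * fromℕ (t P′ m)         ≡⟨ fromℕ-* (t ∸ m) (t P′ m) ⟨
  fromℕ (t P′ suc m)                     ∎
  where
  open ≡-Reasoning
  V : List (Vec (Fin t) m)
  V = allVecs (allFin t) m
  extensions : ∀ v → ∑ (allFin t) (λ x → ⟦ not (x ∈ᵇ v) ⟧) * ⟦ distinct v ⟧ ≡ fromℕ (t ∸ m) * ⟦ distinct v ⟧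
  extensions v with distinct v in eq
  ... | true  = cong (_* 1ℚ) (∑-∉ᵇ v (ℕP.<⇒≤ m<t) (subst T (sym eq) tt))
  ... | false = trans (ℚP.*-zeroʳ (∑ (allFin t) (λ x → ⟦ not (x ∈ᵇ v) ⟧))) (sym (ℚP.*-zeroʳ (fromℕ (t ∸ m))))

∈ᵇ-lookup : ∀ {t m} (v : Vec (Fin t) m) j → T (lookup v j ∈ᵇ v)
∈ᵇ-lookup (y ∷ v) Fin.zero with y FinP.≟ y
... | yes _  = tt
... | no y≢y = ⊥-elim (y≢y refl)
∈ᵇ-lookup (y ∷ v) (Fin.suc j) with lookup v j FinP.≟ y
... | yes _ = tt
... | no _  = ∈ᵇ-lookup v j

∈ᵇ-index : ∀ {t m} (v : Vec (Fin t) m) {x} → T (x ∈ᵇ v) → ∃ λ j → lookup v j ≡ x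
∈ᵇ-index (y ∷ v) {x} x∈v with x FinP.≟ y
... | yes x≡y = Fin.zero , sym x≡y
... | no _ with ∈ᵇ-index v x∈v
...   | j , vj≡x = Fin.suc j , vj≡x

distinct⇒injective : ∀ {t m} (v : Vec (Fin t) m) → T (distinct v) → Injective _≡_ _≡_ (lookup v)
distinct⇒injective (x ∷ v) h {Fin.zero}  {Fin.zero}  _  = refl
distinct⇒injective (x ∷ v) h {Fin.zero}  {Fin.suc j} eq =
  ⊥-elim (T-not⇒¬T (subst (λ y → T (not (y ∈ᵇ v))) eq (proj₁ (Equivalence.to BoolP.T-∧ h))) (∈ᵇ-lookup v j))
distinct⇒injective (x ∷ v) h {Fin.suc i} {Fin.zero}  eq =
  ⊥-elim (T-not⇒¬T (subst (λ y → T (not (y ∈ᵇ v))) (sym eq) (proj₁ (Equivalence.to BoolP.T-∧ h))) (∈ᵇ-lookup v i))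
distinct⇒injective (x ∷ v) h {Fin.suc i} {Fin.suc j} eq =
  cong Fin.suc (distinct⇒injective v (proj₂ (Equivalence.to (BoolP.T-∧ {not (x ∈ᵇ v)}) h)) eq)

injective⇒distinct : ∀ {t m} (v : Vec (Fin t) m) → Injective _≡_ _≡_ (lookup v) → T (distinct v)
injective⇒distinct []      _   = tt
injective⇒distinct (x ∷ v) inj = Equivalence.from BoolP.T-∧ (x∉v , injective⇒distinct v (λ eq → FinP.suc-injective (inj eq)))
  where
  x∉v : T (not (x ∈ᵇ v))
  x∉v with x ∈ᵇ v in eq
  ... | false = tt
  ... | true with ∈ᵇ-index v (subst T (sym eq) tt)
  ...   | j , vj≡x with inj {Fin.zero} {Fin.suc j} (sym vj≡x)
  ...     | ()

isInjective-sound : ∀ {t} (σ : Vec (Fin t) t) → T (isInjective σ) → Injective _≡_ _≡_ (lookup σ)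
isInjective-sound σ h {i} {j} σi≡σj
  with lookup σ i FinP.≟ lookup σ j | i FinP.≟ j | T-allFin-elim _ (T-allFin-elim _ h i) j
... | _        | yes i≡j | _  = i≡j
... | no σi≢σj | no _    | _  = ⊥-elim (σi≢σj σi≡σj)
... | yes _    | no _    | ()

isInjective-complete : ∀ {t} (σ : Vec (Fin t) t) → Injective _≡_ _≡_ (lookup σ) → T (isInjective σ)
isInjective-complete σ inj = T-allFin-intro _ (λ i → T-allFin-intro _ (λ j → pair i j))
  where
  pair : ∀ i j → T (not (lookup σ i ==F lookup σ j) ∨ (i ==F j))
  pair i j with lookup σ i FinP.≟ lookup σ j | i FinP.≟ j
  ... | no _       | _       = tt
  ... | yes _      | yes _   = tt
  ... | yes σi≡σj  | no i≢j  = ⊥-elim (i≢j (inj σi≡σj))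

isInjective≡distinct : ∀ {t} (σ : Vec (Fin t) t) → isInjective σ ≡ distinct σ
isInjective≡distinct σ = T-ext (λ h → injective⇒distinct σ (isInjective-sound σ h))
                               (λ h → isInjective-complete σ (distinct⇒injective σ h))

∑-perms-const : ∀ t c → ∑ (perms t) (λ _ → c) ≡ fromℕ (t !) * c
∑-perms-const t c = begin
  ∑ (perms t) (λ _ → c)
    ≡⟨ ∑-filterᵇ (allMaps t) isInjective _ ⟩
  ∑ (allMaps t) (λ σ → ⟦ isInjective σ ⟧ * c)
    ≡⟨ ∑-cong (allMaps t) (λ σ → cong (λ b → ⟦ b ⟧ * c) (isInjective≡distinct σ)) ⟩
  ∑ (allMaps t) (λ σ → ⟦ distinct σ ⟧ * c)
    ≡⟨ ∑-*ʳ (allMaps t) c _ ⟩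
  ∑ (allMaps t) (λ σ → ⟦ distinct σ ⟧) * c
    ≡⟨ cong (_* c) (∑-distinct t t ℕP.≤-refl) ⟩
  fromℕ (t P′ t) * c
    ≡⟨ cong (λ k → fromℕ k * c) (nP′n≡n! t) ⟩
  fromℕ (t !) * c
    ∎
  where open ≡-Reasoning

-- Central binomial coefficients

C-pos : ∀ m k → k ℕ.≤ m → 1 ℕ.≤ m C k
C-pos m       zero    _         = ℕP.≤-refl
C-pos (suc m) (suc k) (s≤s k≤m) =
  subst (1 ℕ.≤_) (nCk+nC[k+1]≡[n+1]C[k+1] m k) (ℕP.≤-trans (C-pos m k k≤m) (ℕP.m≤m+n _ _))

C-step-≤ : ∀ m k → suc (k ℕ.+ k) ℕ.≤ m → m C k ℕ.≤ m C suc k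
C-step-≤ (suc m) zero    _            = C-pos (suc m) 1 (s≤s z≤n)
C-step-≤ (suc m) (suc k) (s≤s 2k+2≤m) =
  subst₂ ℕ._≤_ (nCk+nC[k+1]≡[n+1]C[k+1] m k) (nCk+nC[k+1]≡[n+1]C[k+1] m (suc k)) pascal-≤
  where
  2+2k≤m : suc (suc (k ℕ.+ k)) ℕ.≤ m
  2+2k≤m = subst (λ z → suc z ℕ.≤ m) (ℕP.+-suc k k) 2k+2≤m
  pascal-≤ : m C k ℕ.+ m C suc k ℕ.≤ m C suc k ℕ.+ m C suc (suc k)
  pascal-≤ with ℕP.m≤n⇒m<n∨m≡n 2+2k≤m
  ... | inj₁ 3+2k≤m = ℕP.+-mono-≤ (C-step-≤ m k (ℕP.<⇒≤ 2+2k≤m))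
                                  (C-step-≤ m (suc k) (subst (λ z → suc (suc z) ℕ.≤ m) (sym (ℕP.+-suc k k)) 3+2k≤m))
  ... | inj₂ refl   = ℕP.≤-reflexive (trans (ℕP.+-comm (m C k) _) (cong (m C suc k ℕ.+_) mirror))
    where
    mirror : m C k ≡ m C suc (suc k)
    mirror = sym (trans (nCk≡nC[n∸k] (s≤s (s≤s (ℕP.m≤n+m k k)))) (cong (m C_) (ℕP.m+n∸n≡m k k)))

C-mono-below-half : ∀ {m j h} → j ℕ.≤ h → h ℕ.+ h ℕ.≤ m → m C j ℕ.≤ m C h
C-mono-below-half {h = zero}  z≤n   _      = ℕP.≤-refl
C-mono-below-half {m} {j} {suc h} j≤1+h 2h+2≤m with ℕP.m≤n⇒m<n∨m≡n j≤1+h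
... | inj₂ refl      = ℕP.≤-refl
... | inj₁ (s≤s j≤h) = ℕP.≤-trans (C-mono-below-half j≤h (ℕP.≤-trans (ℕP.n≤1+n _) 2h+1≤m)) (C-step-≤ m h 2h+1≤m)
  where
  2h+1≤m : suc (h ℕ.+ h) ℕ.≤ m
  2h+1≤m = ℕP.≤-trans (ℕP.n≤1+n _) (subst (ℕ._≤ m) (ℕP.+-suc (suc h) h) 2h+2≤m)

half*2≡half+half : ∀ m → m ℕ./ 2 ℕ.* 2 ≡ m ℕ./ 2 ℕ.+ m ℕ./ 2
half*2≡half+half m = trans (ℕP.*-comm (m ℕ./ 2) 2) (cong (m ℕ./ 2 ℕ.+_) (ℕP.+-identityʳ (m ℕ./ 2)))

half+half≤ : ∀ m → m ℕ./ 2 ℕ.+ m ℕ./ 2 ℕ.≤ m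
half+half≤ m = subst (ℕ._≤ m) (half*2≡half+half m) (m/n*n≤m m 2)

≤1+half+half : ∀ m → m ℕ.≤ suc (m ℕ./ 2 ℕ.+ m ℕ./ 2)
≤1+half+half m = begin
  m                                        ≡⟨ m≡m%n+[m/n]*n m 2 ⟩
  m ℕ.% 2 ℕ.+ m ℕ./ 2 ℕ.* 2                ≤⟨ ℕP.+-monoˡ-≤ _ (ℕP.<⇒≤pred (m%n<n m 2)) ⟩
  1 ℕ.+ m ℕ./ 2 ℕ.* 2                      ≡⟨ cong suc (half*2≡half+half m) ⟩
  suc (m ℕ./ 2 ℕ.+ m ℕ./ 2)                ∎
  where open ℕP.≤-Reasoning

C≤central : ∀ {m k} → k ℕ.≤ m → m C k ℕ.≤ m C (m ℕ./ 2)
C≤central {m} {k} k≤m with k ℕP.≤? m ℕ./ 2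
... | yes k≤half = C-mono-below-half k≤half (half+half≤ m)
... | no  k≰half = subst (ℕ._≤ m C (m ℕ./ 2)) (sym (nCk≡nC[n∸k] k≤m)) (C-mono-below-half m∸k≤half (half+half≤ m))
  where
  m∸k≤half : m ∸ k ℕ.≤ m ℕ./ 2
  m∸k≤half = ℕP.≤-trans (ℕP.∸-monoʳ-≤ m (ℕP.≰⇒> k≰half))
                        (ℕP.m≤n+o⇒m∸n≤o m (suc (m ℕ./ 2)) (≤1+half+half m))

binomProd-suc : ∀ t → binomProd (suc t) ≡ binomProd t ℕ.* (t C (t ℕ./ 2))
binomProd-suc t = begin
  ℕL.product (map central (upTo (suc t)))
    ≡⟨ cong (λ l → ℕL.product (map central l)) (ListP.upTo-∷ʳ t) ⟨
  ℕL.product (map central (upTo t ++ t ∷ []))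
    ≡⟨ cong ℕL.product (ListP.map-++ central (upTo t) (t ∷ [])) ⟩
  ℕL.product (map central (upTo t) ++ central t ∷ [])
    ≡⟨ product-++ (map central (upTo t)) (central t ∷ []) ⟩
  binomProd t ℕ.* (central t ℕ.* 1)
    ≡⟨ cong (binomProd t ℕ.*_) (ℕP.*-identityʳ (central t)) ⟩
  binomProd t ℕ.* central t
    ∎
  where
  open ≡-Reasoning
  central : ℕ → ℕ
  central m = m C (m ℕ./ 2)

binomProd-pos : ∀ t → 1 ℕ.≤ binomProd t
binomProd-pos zero    = ℕP.≤-refl
binomProd-pos (suc t) = subst (1 ℕ.≤_) (sym (binomProd-suc t))
  (ℕP.*-mono-≤ (binomProd-pos t) (C-pos t (t ℕ./ 2) (m/n≤m t 2)))

injective⇒surjective : ∀ {t} (f : Fin t → Fin t) → Injective _≡_ _≡_ f → ∀ y → ∃ λ x → f x ≡ y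
injective⇒surjective {suc k} f inj y with FinP.any? (λ x → f x FinP.≟ y)
... | yes hit = hit
... | no miss = ⊥-elim (ℕP.1+n≰n (FinP.injective⇒≤ squeeze-injective))
  where
  y≢f : ∀ x → y ≢ f x
  y≢f x y≡fx = miss (x , sym y≡fx)
  squeeze : Fin (suc k) → Fin k
  squeeze x = Fin.punchOut (y≢f x)
  squeeze-injective : Injective _≡_ _≡_ squeeze
  squeeze-injective {x} {x′} eq = inj (FinP.punchOut-injective (y≢f x) (y≢f x′) eq)

_∘ᵛ_ : ∀ {t} → Vec (Fin t) t → Vec (Fin t) t → Vec (Fin t) t
α ∘ᵛ τ = Vec.tabulate (λ i → lookup α (lookup τ i))

lookup-∘ᵛ : ∀ {t} (α τ : Vec (Fin t) t) i → lookup (α ∘ᵛ τ) i ≡ lookup α (lookup τ i)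
lookup-∘ᵛ α τ i = VecP.lookup∘tabulate _ i

∘ᵛ-cancelʳ : ∀ {t} (α τ ρ : Vec (Fin t) t) → (∀ i → lookup τ (lookup ρ i) ≡ i) → (α ∘ᵛ τ) ∘ᵛ ρ ≡ α
∘ᵛ-cancelʳ α τ ρ τρ = trans
  (VecP.tabulate-cong (λ i → trans (lookup-∘ᵛ α τ (lookup ρ i)) (cong (lookup α) (τρ i))))
  (VecP.tabulate∘lookup α)

allMaps-enumerates : ∀ t → Enumerates (VecP.≡-dec FinP._≟_) (allMaps t)
allMaps-enumerates t = allVecs-enumerates (allFin-enumerates t) t

relabel : ∀ {t} → Adj t → Vec (Fin t) t → Adj t
relabel G σ i j = G (lookup σ i) (lookup σ j)

-- isIsoVia H G σ unfolds to sameAdj H (relabel G σ).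
sameAdj : ∀ {t} → Adj t → Adj t → Bool
sameAdj {t} H K = allB (allFin t) λ i → allB (allFin t) λ j → K i j ==B H i j

sameAdj-sound : ∀ {t} (H K : Adj t) → T (sameAdj H K) → ∀ i j → K i j ≡ H i j
sameAdj-sound H K h i j = toWitness (T-allFin-elim _ (T-allFin-elim _ h i) j)

sameAdj-complete : ∀ {t} (H K : Adj t) → (∀ i j → K i j ≡ H i j) → T (sameAdj H K)
sameAdj-complete H K h = T-allFin-intro _ (λ i → T-allFin-intro _ (λ j → fromWitness (h i j)))

module Relabel {t} (τ : Vec (Fin t) t) (τ-inj : Injective _≡_ _≡_ (lookup τ)) where

  τ⁻¹ : Vec (Fin t) t
  τ⁻¹ = Vec.tabulate (λ y → proj₁ (injective⇒surjective (lookup τ) τ-inj y))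

  τ∘τ⁻¹ : ∀ y → lookup τ (lookup τ⁻¹ y) ≡ y
  τ∘τ⁻¹ y = trans (cong (lookup τ) (VecP.lookup∘tabulate _ y)) (proj₂ (injective⇒surjective (lookup τ) τ-inj y))

  τ⁻¹∘τ : ∀ x → lookup τ⁻¹ (lookup τ x) ≡ x
  τ⁻¹∘τ x = τ-inj (τ∘τ⁻¹ (lookup τ x))

  lookup-∘ᵛ-τ⁻¹ : ∀ α y → lookup (α ∘ᵛ τ) (lookup τ⁻¹ y) ≡ lookup α y
  lookup-∘ᵛ-τ⁻¹ α y = trans (lookup-∘ᵛ α τ (lookup τ⁻¹ y)) (cong (lookup α) (τ∘τ⁻¹ y))

  ∑-allMaps-∘ᵛ : ∀ f → ∑ (allMaps t) (λ α → f (α ∘ᵛ τ)) ≡ ∑ (allMaps t) f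
  ∑-allMaps-∘ᵛ = ∑-reindex (VecP.≡-dec FinP._≟_) {allMaps t} (allMaps-enumerates t) (_∘ᵛ τ) (_∘ᵛ τ⁻¹)
    (λ α → ∘ᵛ-cancelʳ α τ τ⁻¹ τ∘τ⁻¹) (λ β → ∘ᵛ-cancelʳ β τ⁻¹ τ τ⁻¹∘τ)

  isInjective-∘ᵛ : ∀ α → isInjective (α ∘ᵛ τ) ≡ isInjective α
  isInjective-∘ᵛ α = T-ext
    (λ h → isInjective-complete α (λ {i} {j} αi≡αj →
      let τ⁻¹i≡τ⁻¹j = isInjective-sound (α ∘ᵛ τ) h
                        (trans (lookup-∘ᵛ-τ⁻¹ α i) (trans αi≡αj (sym (lookup-∘ᵛ-τ⁻¹ α j))))
      in trans (sym (τ∘τ⁻¹ i)) (trans (cong (lookup τ) τ⁻¹i≡τ⁻¹j) (τ∘τ⁻¹ j))))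
    (λ h → isInjective-complete (α ∘ᵛ τ) (λ {i} {j} eq →
      τ-inj (isInjective-sound α h (trans (sym (lookup-∘ᵛ α τ i)) (trans eq (lookup-∘ᵛ α τ j))))))

  isIsoVia-∘ᵛ : ∀ {H G} → (∀ i j → relabel G τ i j ≡ H i j) → ∀ α → isIsoVia H G (α ∘ᵛ τ) ≡ isIsoVia G G α
  isIsoVia-∘ᵛ {H} {G} τ-iso α = T-ext
    (λ h → sameAdj-complete G (relabel G α) (λ k l → begin
      G (lookup α k) (lookup α l)
        ≡⟨ cong₂ G (lookup-∘ᵛ-τ⁻¹ α k) (lookup-∘ᵛ-τ⁻¹ α l) ⟨
      G (lookup (α ∘ᵛ τ) (lookup τ⁻¹ k)) (lookup (α ∘ᵛ τ) (lookup τ⁻¹ l))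
        ≡⟨ sameAdj-sound H (relabel G (α ∘ᵛ τ)) h (lookup τ⁻¹ k) (lookup τ⁻¹ l) ⟩
      H (lookup τ⁻¹ k) (lookup τ⁻¹ l)
        ≡⟨ τ-iso (lookup τ⁻¹ k) (lookup τ⁻¹ l) ⟨
      G (lookup τ (lookup τ⁻¹ k)) (lookup τ (lookup τ⁻¹ l))
        ≡⟨ cong₂ G (τ∘τ⁻¹ k) (τ∘τ⁻¹ l) ⟩
      G k l
        ∎))
    (λ h → sameAdj-complete H (relabel G (α ∘ᵛ τ)) (λ i j → begin
      G (lookup (α ∘ᵛ τ) i) (lookup (α ∘ᵛ τ) j)
        ≡⟨ cong₂ G (lookup-∘ᵛ α τ i) (lookup-∘ᵛ α τ j) ⟩
      G (lookup α (lookup τ i)) (lookup α (lookup τ j))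
        ≡⟨ sameAdj-sound G (relabel G α) h (lookup τ i) (lookup τ j) ⟩
      G (lookup τ i) (lookup τ j)
        ≡⟨ τ-iso i j ⟩
      H i j
        ∎))
    where open ≡-Reasoning

length-filterᵇ : ∀ (xs : List A) p → fromℕ (length (filterᵇ p xs)) ≡ ∑ xs (λ x → ⟦ p x ⟧)
length-filterᵇ xs p = begin
  fromℕ (length (filterᵇ p xs))            ≡⟨ ℚP.*-identityʳ _ ⟨
  fromℕ (length (filterᵇ p xs)) * 1ℚ       ≡⟨ ∑-const (filterᵇ p xs) 1ℚ ⟨
  ∑ (filterᵇ p xs) (λ _ → 1ℚ)              ≡⟨ ∑-filterᵇ xs p (λ _ → 1ℚ) ⟩
  ∑ xs (λ x → ⟦ p x ⟧ * 1ℚ)                ≡⟨ ∑-cong xs (λ x → ℚP.*-identityʳ ⟦ p x ⟧) ⟩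
  ∑ xs (λ x → ⟦ p x ⟧)                     ∎
  where open ≡-Reasoning

∑-⟦⟧-none : ∀ (xs : List A) p → anyB xs p ≡ false → ∑ xs (λ x → ⟦ p x ⟧) ≡ 0ℚ
∑-⟦⟧-none []       p _ = refl
∑-⟦⟧-none (x ∷ xs) p none with p x
... | false = trans (ℚP.+-identityˡ _) (∑-⟦⟧-none xs p none)

-- autCount G unfolds to #aut (adj G).
#aut : ∀ {t} → Adj t → ℕ
#aut {t} G = length (filterᵇ (isIsoVia G G) (perms t))

-- Precomposition with an isomorphism τ from H to G maps Aut(G) bijectively onto the isomorphisms from H to G.
∑-isIsoVia≡#aut : ∀ {t} (H G : Adj t) τ → τ ∈ perms t → T (isIsoVia H G τ) →
                   ∑ (perms t) (λ σ → ⟦ isIsoVia H G σ ⟧) ≡ fromℕ (#aut G)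
∑-isIsoVia≡#aut {t} H G τ τ∈perms τ-iso = begin
  ∑ (perms t) (λ σ → ⟦ isIsoVia H G σ ⟧)                  ≡⟨ ∑-filterᵇ (allMaps t) isInjective (λ σ → ⟦ isIsoVia H G σ ⟧) ⟩
  ∑ (allMaps t) (F H G)                                   ≡⟨ ∑-allMaps-∘ᵛ (F H G) ⟨
  ∑ (allMaps t) (λ α → F H G (α ∘ᵛ τ))                    ≡⟨ ∑-cong (allMaps t) relabel-F ⟩
  ∑ (allMaps t) (F G G)                                   ≡⟨ ∑-filterᵇ (allMaps t) isInjective (λ σ → ⟦ isIsoVia G G σ ⟧) ⟨
  ∑ (perms t) (λ σ → ⟦ isIsoVia G G σ ⟧)                  ≡⟨ length-filterᵇ (perms t) (isIsoVia G G) ⟨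
  fromℕ (#aut G)       ∎
  where
  open ≡-Reasoning
  open Relabel τ (isInjective-sound τ (proj₂ (∈-filter⁻ (T? ∘ isInjective) {xs = allMaps t} τ∈perms)))
  F : Adj t → Adj t → Vec (Fin t) t → ℚ
  F H′ G′ α = ⟦ isInjective α ⟧ * ⟦ isIsoVia H′ G′ α ⟧
  relabel-F : ∀ α → F H G (α ∘ᵛ τ) ≡ F G G α
  relabel-F α = cong₂ (λ a b → ⟦ a ⟧ * ⟦ b ⟧) (isInjective-∘ᵛ α) (isIsoVia-∘ᵛ (sameAdj-sound H (relabel G τ) τ-iso) α)

∑-isIsoVia : ∀ {t} (H G : Adj t) →
  ∑ (perms t) (λ σ → ⟦ isIsoVia H G σ ⟧) ≡ (if isomorphic H G then fromℕ (#aut G) else 0ℚ)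
∑-isIsoVia {t} H G = by-cases (isomorphic H G) refl
  where
  by-cases : ∀ b → isomorphic H G ≡ b →
             ∑ (perms t) (λ σ → ⟦ isIsoVia H G σ ⟧) ≡ (if b then fromℕ (#aut G) else 0ℚ)
  by-cases false none = ∑-⟦⟧-none (perms t) (isIsoVia H G) none
  by-cases true  some =
    let τ , τ∈perms , τ-iso = find (any⁻ (isIsoVia H G) (perms t) (subst T (sym some) tt))
    in  ∑-isIsoVia≡#aut H G τ τ∈perms τ-iso

old : ∀ {m} → Fin m → Fin (suc m)
old = Fin.inject₁

new : ∀ m → Fin (suc m)
new = Fin.fromℕ

isOld-old : ∀ {m} (a : Fin m) → isOld (old a) ≡ just a
isOld-old {suc m} Fin.zero    = refl
isOld-old {suc m} (Fin.suc a) = cong (Maybe.map Fin.suc) (isOld-old a)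

isOld-new : ∀ m → isOld (new m) ≡ nothing
isOld-new zero    = refl
isOld-new (suc m) = cong (Maybe.map Fin.suc) (isOld-new m)

old-or-new : ∀ {m} (i : Fin (suc m)) → (∃ λ a → i ≡ old a) ⊎ i ≡ new m
old-or-new {zero}  Fin.zero    = inj₂ refl
old-or-new {suc m} Fin.zero    = inj₁ (Fin.zero , refl)
old-or-new {suc m} (Fin.suc i) with old-or-new i
... | inj₁ (a , i≡a) = inj₁ (Fin.suc a , cong Fin.suc i≡a)
... | inj₂ i≡new     = inj₂ (cong Fin.suc i≡new)

module _ {m} (H : Adj m) (S : Vec Bool m) where

  extend-old-old : ∀ a b → extend H S (old a) (old b) ≡ H a b
  extend-old-old a b rewrite isOld-old a | isOld-old b = refl

  extend-old-new : ∀ a → extend H S (old a) (new m) ≡ lookup S a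
  extend-old-new a rewrite isOld-old a | isOld-new m = refl

  extend-new-old : ∀ b → extend H S (new m) (old b) ≡ lookup S b
  extend-new-old b rewrite isOld-old b | isOld-new m = refl

  extend-new-new : extend H S (new m) (new m) ≡ false
  extend-new-new rewrite isOld-new m = refl

restrict : ∀ {m} → Adj (suc m) → Adj m
restrict K a b = K (old a) (old b)

newRow : ∀ {m} → Adj (suc m) → Vec Bool m
newRow {m} K = Vec.tabulate (λ a → K (old a) (new m))

_≟ᵛ_ : ∀ {m} → DecidableEquality (Vec Bool m)
_≟ᵛ_ = VecP.≡-dec BoolP._≟_

module _ {m} (K : Adj (suc m)) (H : Adj m) (S : Vec Bool m) where

  sameAdj-extend⇒ : T (sameAdj (extend H S) K) → T (sameAdj H (restrict K)) × S ≡ newRow K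
  sameAdj-extend⇒ h =
      sameAdj-complete H (restrict K) (λ a b → trans (K≡ (old a) (old b)) (extend-old-old H S a b))
    , trans (sym (VecP.tabulate∘lookup S))
            (VecP.tabulate-cong (λ a → sym (trans (K≡ (old a) (new m)) (extend-old-new H S a))))
    where
    K≡ : ∀ i j → K i j ≡ extend H S i j
    K≡ = sameAdj-sound (extend H S) K h

  sameAdj-extend⇐ : (∀ i j → K i j ≡ K j i) → (∀ i → K i i ≡ false) →
                    T (sameAdj H (restrict K)) → S ≡ newRow K → T (sameAdj (extend H S) K)
  sameAdj-extend⇐ K-sym K-irrefl h refl = sameAdj-complete (extend H S) K K≡extend
    where
    K≡H : ∀ a b → K (old a) (old b) ≡ H a b
    K≡H = sameAdj-sound H (restrict K) h
    K≡S : ∀ a → K (old a) (new m) ≡ lookup S a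
    K≡S a = sym (VecP.lookup∘tabulate (λ a → K (old a) (new m)) a)
    K≡extend : ∀ i j → K i j ≡ extend H S i j
    K≡extend i j with old-or-new i | old-or-new j
    ... | inj₁ (a , refl) | inj₁ (b , refl) = trans (K≡H a b) (sym (extend-old-old H S a b))
    ... | inj₁ (a , refl) | inj₂ refl       = trans (K≡S a) (sym (extend-old-new H S a))
    ... | inj₂ refl       | inj₁ (b , refl) = trans (K-sym _ _) (trans (K≡S b) (sym (extend-new-old H S b)))
    ... | inj₂ refl       | inj₂ refl       = trans (K-irrefl _) (sym (extend-new-new H S))

sameAdj-extend : ∀ {m} (K : Adj (suc m)) → (∀ i j → K i j ≡ K j i) → (∀ i → K i i ≡ false) → ∀ H S →
                 sameAdj (extend H S) K ≡ sameAdj H (restrict K) ∧ does (S ≟ᵛ newRow K)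
sameAdj-extend K K-sym K-irrefl H S with S ≟ᵛ newRow K
... | yes S≡row = T-ext (λ h → Equivalence.from BoolP.T-∧ (proj₁ (sameAdj-extend⇒ K H S h) , tt))
                        (λ h → sameAdj-extend⇐ K H S K-sym K-irrefl (proj₁ (Equivalence.to BoolP.T-∧ h)) S≡row)
... | no  S≢row = T-ext (λ h → ⊥-elim (S≢row (proj₂ (sameAdj-extend⇒ K H S h))))
                        (λ h → ⊥-elim (proj₂ (Equivalence.to (BoolP.T-∧ {sameAdj H (restrict K)}) h)))

-- Probabilities of labelled graphs

-- Pr[G_{n+1} = K] as labelled graphs, whereas likelihood only asks for G_{n+1} ≅ K.
exactProb : ∀ {n} → Adj (suc n) → ℚ
exactProb {n} K = ∑ (process n) (λ p → proj₂ p * ⟦ sameAdj (proj₁ p) K ⟧)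

stepProb : ℕ → ℕ → ℚ
stepProb m k = inv (suc m) * inv (m C k)

countTrue≤ : ∀ {m} (v : Vec Bool m) → countTrue v ℕ.≤ m
countTrue≤ []          = z≤n
countTrue≤ (true ∷ v)  = s≤s (countTrue≤ v)
countTrue≤ (false ∷ v) = ℕP.m≤n⇒m≤1+n (countTrue≤ v)

∑-subsetsOfSize : ∀ m k (r : Vec Bool m) →
  ∑ (subsetsOfSize m k) (λ S → ⟦ does (S ≟ᵛ r) ⟧) ≡ ⟦ does (k ℕP.≟ countTrue r) ⟧
∑-subsetsOfSize m k r = begin
  ∑ (subsetsOfSize m k) (λ S → ⟦ does (S ≟ᵛ r) ⟧)
    ≡⟨ ∑-filterᵇ (allVecs bools m) (λ S → isYes (countTrue S ℕP.≟ k)) (λ S → ⟦ does (S ≟ᵛ r) ⟧) ⟩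
  ∑ (allVecs bools m) (λ S → ⟦ isYes (countTrue S ℕP.≟ k) ⟧ * ⟦ does (S ≟ᵛ r) ⟧)
    ≡⟨ ∑-cong (allVecs bools m) (λ S → ℚP.*-comm ⟦ isYes (countTrue S ℕP.≟ k) ⟧ ⟦ does (S ≟ᵛ r) ⟧) ⟩
  ∑ (allVecs bools m) (λ S → ⟦ does (S ≟ᵛ r) ⟧ * ⟦ isYes (countTrue S ℕP.≟ k) ⟧)
    ≡⟨ ∑-pick _≟ᵛ_ (allVecs bools m) r (allVecs-enumerates bools-enumerates m r)
                                                    (λ S → ⟦ isYes (countTrue S ℕP.≟ k) ⟧) ⟩
  ⟦ isYes (countTrue r ℕP.≟ k) ⟧
    ≡⟨ cong ⟦_⟧ (trans (isYes≗does (countTrue r ℕP.≟ k)) (does-⇔ (mk⇔ sym sym) (countTrue r ℕP.≟ k) (k ℕP.≟ countTrue r))) ⟩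
  ⟦ does (k ℕP.≟ countTrue r) ⟧
    ∎
  where open ≡-Reasoning

∑-stepProb : ∀ m (r : Vec Bool m) →
  ∑ (upTo (suc m)) (λ k → stepProb m k * ∑ (subsetsOfSize m k) (λ S → ⟦ does (S ≟ᵛ r) ⟧))
    ≡ stepProb m (countTrue r)
∑-stepProb m r = begin
  ∑ (upTo (suc m)) (λ k → stepProb m k * ∑ (subsetsOfSize m k) (λ S → ⟦ does (S ≟ᵛ r) ⟧))
    ≡⟨ ∑-cong (upTo (suc m)) (λ k → trans (cong (stepProb m k *_) (∑-subsetsOfSize m k r))
                                          (ℚP.*-comm (stepProb m k) ⟦ does (k ℕP.≟ countTrue r) ⟧)) ⟩
  ∑ (upTo (suc m)) (λ k → ⟦ does (k ℕP.≟ countTrue r) ⟧ * stepProb m k)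
    ≡⟨ ∑-pick ℕP._≟_ (upTo (suc m)) (countTrue r) (upTo-multiplicity (s≤s (countTrue≤ r))) (stepProb m) ⟩
  stepProb m (countTrue r)
    ∎
  where open ≡-Reasoning

module _ {m} (K : Adj (suc m)) (K-sym : ∀ i j → K i j ≡ K j i) (K-irrefl : ∀ i → K i i ≡ false) where

  private
    r : Vec Bool m
    r = newRow K
    f : Adj (suc m) × ℚ → ℚ
    f p = proj₂ p * ⟦ sameAdj (proj₁ p) K ⟧
    [S≡r] : Vec Bool m → ℚ
    [S≡r] S = ⟦ does (S ≟ᵛ r) ⟧

  ∑-extensions : ∀ H w →
    ∑ (concatMap (λ k → map (λ S → extend H S , w * stepProb m k) (subsetsOfSize m k)) (upTo (suc m))) f
      ≡ (w * ⟦ sameAdj H (restrict K) ⟧) * stepProb m (countTrue r)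
  ∑-extensions H w = begin
    ∑ (concatMap (λ k → map (λ S → extend H S , w * stepProb m k) (subsetsOfSize m k)) (upTo (suc m))) f
      ≡⟨ ∑-concatMap (upTo (suc m)) (λ k → map (λ S → extend H S , w * stepProb m k) (subsetsOfSize m k)) f ⟩
    ∑ (upTo (suc m)) (λ k → ∑ (map (λ S → extend H S , w * stepProb m k) (subsetsOfSize m k)) f)
      ≡⟨ ∑-cong (upTo (suc m)) (λ k → ∑-map (subsetsOfSize m k) (λ S → extend H S , w * stepProb m k) f) ⟩
    ∑ (upTo (suc m)) (λ k → ∑ (subsetsOfSize m k) (λ S → (w * stepProb m k) * ⟦ sameAdj (extend H S) K ⟧))
      ≡⟨ ∑-cong (upTo (suc m)) (λ k → ∑-cong (subsetsOfSize m k) (factor k)) ⟩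
    ∑ (upTo (suc m)) (λ k → ∑ (subsetsOfSize m k) (λ S → W * (stepProb m k * [S≡r] S)))
      ≡⟨ ∑-cong (upTo (suc m)) (λ k → trans (∑-*ˡ (subsetsOfSize m k) W (λ S → stepProb m k * [S≡r] S))
                                            (cong (W *_) (∑-*ˡ (subsetsOfSize m k) (stepProb m k) [S≡r]))) ⟩
    ∑ (upTo (suc m)) (λ k → W * (stepProb m k * ∑ (subsetsOfSize m k) [S≡r]))
      ≡⟨ ∑-*ˡ (upTo (suc m)) W (λ k → stepProb m k * ∑ (subsetsOfSize m k) [S≡r]) ⟩
    W * ∑ (upTo (suc m)) (λ k → stepProb m k * ∑ (subsetsOfSize m k) [S≡r])
      ≡⟨ cong (W *_) (∑-stepProb m r) ⟩
    W * stepProb m (countTrue r)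
      ∎
    where
    open ≡-Reasoning
    open ℚSolver.+-*-Solver using (solve; _:*_; _:=_)
    W : ℚ
    W = w * ⟦ sameAdj H (restrict K) ⟧
    factor : ∀ k S → (w * stepProb m k) * ⟦ sameAdj (extend H S) K ⟧ ≡ W * (stepProb m k * [S≡r] S)
    factor k S = begin
      (w * stepProb m k) * ⟦ sameAdj (extend H S) K ⟧
        ≡⟨ cong (λ b → (w * stepProb m k) * ⟦ b ⟧) (sameAdj-extend K K-sym K-irrefl H S) ⟩
      (w * stepProb m k) * ⟦ sameAdj H (restrict K) ∧ does (S ≟ᵛ r) ⟧
        ≡⟨ cong ((w * stepProb m k) *_) (⟦∧⟧ (sameAdj H (restrict K)) (does (S ≟ᵛ r))) ⟩
      (w * stepProb m k) * (⟦ sameAdj H (restrict K) ⟧ * [S≡r] S)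
        ≡⟨ solve 4 (λ a b c d → (a :* b) :* (c :* d) := (a :* c) :* (b :* d)) refl
                 w (stepProb m k) ⟦ sameAdj H (restrict K) ⟧ ([S≡r] S) ⟩
      W * (stepProb m k * [S≡r] S)
        ∎

-- A run produces K exactly when it produces restrict K and then joins the new vertex to newRow K.
exactProb-step : ∀ {n} (K : Adj (suc (suc n))) → (∀ i j → K i j ≡ K j i) → (∀ i → K i i ≡ false) →
                 exactProb K ≡ exactProb (restrict K) * stepProb (suc n) (countTrue (newRow K))
exactProb-step {n} K K-sym K-irrefl = begin
  exactProb K
    ≡⟨ ∑-concatMap (process n) _ (λ p → proj₂ p * ⟦ sameAdj (proj₁ p) K ⟧) ⟩
  ∑ (process n) (λ p → ∑ (concatMap (λ k → map (λ S → extend (proj₁ p) S , proj₂ p * stepProb (suc n) k)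
                                               (subsetsOfSize (suc n) k)) (upTo (suc (suc n))))
                         (λ p → proj₂ p * ⟦ sameAdj (proj₁ p) K ⟧))
    ≡⟨ ∑-cong (process n) (λ p → ∑-extensions K K-sym K-irrefl (proj₁ p) (proj₂ p)) ⟩
  ∑ (process n) (λ p → (proj₂ p * ⟦ sameAdj (proj₁ p) (restrict K) ⟧) * c)
    ≡⟨ ∑-*ʳ (process n) c (λ p → proj₂ p * ⟦ sameAdj (proj₁ p) (restrict K) ⟧) ⟩
  exactProb (restrict K) * c
    ∎
  where
  open ≡-Reasoning
  c : ℚ
  c = stepProb (suc n) (countTrue (newRow K))

stepProb-nonNeg : ∀ m k → 0ℚ ≤ stepProb m k
stepProb-nonNeg m k = ℚP.≤-trans (ℚP.≤-reflexive (sym (ℚP.*-zeroˡ (inv (m C k)))))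
  (ℚP.*-monoʳ-≤-nonNeg (inv (m C k)) {{ℚ.nonNegative (inv-nonNeg (m C k))}} (inv-nonNeg (suc m)))

stepProb-bounds : ∀ m k → k ℕ.≤ m →
  (inv (suc m) * inv (m C (m ℕ./ 2)) ≤ stepProb m k) × (stepProb m k ≤ inv (suc m))
stepProb-bounds m k k≤m =
    ℚP.*-monoˡ-≤-nonNeg (inv (suc m)) (inv-antimono (C-pos m k k≤m) (C≤central k≤m))
  , subst (stepProb m k ≤_) (ℚP.*-identityʳ (inv (suc m)))
      (ℚP.*-monoˡ-≤-nonNeg (inv (suc m)) (inv≤1 (C-pos m k k≤m)))
  where
  instance
    inv-nonNegative : ℚ.NonNegative (inv (suc m))
    inv-nonNegative = ℚ.nonNegative (inv-nonNeg (suc m))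

exactProb-single : (K : Adj 1) → K Fin.zero Fin.zero ≡ false → exactProb {0} K ≡ 1ℚ
exactProb-single K K00≡false = cong (λ b → 1ℚ * ⟦ ((b ==B false) ∧ true) ∧ true ⟧ + 0ℚ) K00≡false

exactProb-bounds : ∀ n (K : Adj (suc n)) → (∀ i j → K i j ≡ K j i) → (∀ i → K i i ≡ false) →
  (inv (suc n ! ℕ.* binomProd (suc n)) ≤ exactProb K) × (exactProb K ≤ inv (suc n !))
exactProb-bounds zero K K-sym K-irrefl =
  ℚP.≤-reflexive (sym (exactProb-single K (K-irrefl Fin.zero))) , ℚP.≤-reflexive (exactProb-single K (K-irrefl Fin.zero))
exactProb-bounds (suc n) K K-sym K-irrefl = lower , upper
  where
  open ℚSolver.+-*-Solver using (solve; _:*_; _:=_)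
  d s F Π Cmid : ℕ
  d    = countTrue (newRow K)
  s    = suc (suc n)
  F    = suc n !
  Π    = binomProd (suc n)
  Cmid = suc n C (suc n ℕ./ 2)
  IH : (inv (F ℕ.* Π) ≤ exactProb (restrict K)) × (exactProb (restrict K) ≤ inv F)
  IH = exactProb-bounds n (restrict K) (λ a b → K-sym (old a) (old b)) (λ a → K-irrefl (old a))
  c-bounds : (inv s * inv Cmid ≤ stepProb (suc n) d) × (stepProb (suc n) d ≤ inv s)
  c-bounds = stepProb-bounds (suc n) d (countTrue≤ (newRow K))
  0≤exactProb : 0ℚ ≤ exactProb (restrict K)
  0≤exactProb = ℚP.≤-trans (inv-nonNeg (F ℕ.* Π)) (proj₁ IH)

  upper : exactProb K ≤ inv (s !)
  upper = subst₂ _≤_ (sym (exactProb-step K K-sym K-irrefl)) factorial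
    (*-mono-≤-nonNeg 0≤exactProb (inv-nonNeg s) (proj₂ IH) (proj₂ c-bounds))
    where
    factorial : inv F * inv s ≡ inv (s !)
    factorial = trans (ℚP.*-comm (inv F) (inv s)) (sym (inv-* s F))

  lower : inv (s ! ℕ.* binomProd s) ≤ exactProb K
  lower = subst₂ _≤_ factorial (sym (exactProb-step K K-sym K-irrefl))
    (*-mono-≤-nonNeg (inv-nonNeg (F ℕ.* Π)) (stepProb-nonNeg (suc n) d) (proj₁ IH) (proj₁ c-bounds))
    where
    open ≡-Reasoning
    factorial : inv (F ℕ.* Π) * (inv s * inv Cmid) ≡ inv (s ! ℕ.* binomProd s)
    factorial = begin
      inv (F ℕ.* Π) * (inv s * inv Cmid)          ≡⟨ cong (_* (inv s * inv Cmid)) (inv-* F Π) ⟩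
      (inv F * inv Π) * (inv s * inv Cmid)        ≡⟨ solve 4 (λ a b x y → (a :* b) :* (x :* y) := (x :* a) :* (b :* y))
                                                           refl (inv F) (inv Π) (inv s) (inv Cmid) ⟩
      (inv s * inv F) * (inv Π * inv Cmid)        ≡⟨ cong₂ _*_ (inv-* s F) (inv-* Π Cmid) ⟨
      inv (s ℕ.* F) * inv (Π ℕ.* Cmid)            ≡⟨ inv-* (s ℕ.* F) (Π ℕ.* Cmid) ⟨
      inv (s ℕ.* F ℕ.* (Π ℕ.* Cmid))              ≡⟨ cong (λ z → inv (s ! ℕ.* z)) (binomProd-suc (suc n)) ⟨
      inv (s ! ℕ.* binomProd s)                   ∎

∑-exactProb-relabel-bounds : ∀ n (G : SimpleGraph (suc n)) →
  (inv (binomProd (suc n)) ≤ ∑ (perms (suc n)) (λ σ → exactProb (relabel (adj G) σ)))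
  × (∑ (perms (suc n)) (λ σ → exactProb (relabel (adj G) σ)) ≤ 1ℚ)
∑-exactProb-relabel-bounds n G =
    subst (_≤ ∑ (perms t) term) lower-sum (∑-mono-≤ (perms t) (λ σ → proj₁ (bounds σ)))
  , subst (∑ (perms t) term ≤_) upper-sum (∑-mono-≤ (perms t) (λ σ → proj₂ (bounds σ)))
  where
  open ≡-Reasoning
  t : ℕ
  t = suc n
  term : Vec (Fin t) t → ℚ
  term σ = exactProb (relabel (adj G) σ)
  bounds : ∀ σ → (inv (t ! ℕ.* binomProd t) ≤ term σ) × (term σ ≤ inv (t !))
  bounds σ = exactProb-bounds n (relabel (adj G) σ) (λ i j → SimpleGraph.sym G (lookup σ i) (lookup σ j))
                                                   (λ i → SimpleGraph.irrefl G (lookup σ i))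
  upper-sum : ∑ (perms t) (λ _ → inv (t !)) ≡ 1ℚ
  upper-sum = trans (∑-perms-const t (inv (t !))) (fromℕ-inverseˡ (ℕP.1≤n! t))
  lower-sum : ∑ (perms t) (λ _ → inv (t ! ℕ.* binomProd t)) ≡ inv (binomProd t)
  lower-sum = begin
    ∑ (perms t) (λ _ → inv (t ! ℕ.* binomProd t))       ≡⟨ ∑-perms-const t (inv (t ! ℕ.* binomProd t)) ⟩
    fromℕ (t !) * inv (t ! ℕ.* binomProd t)             ≡⟨ cong (fromℕ (t !) *_) (inv-* (t !) (binomProd t)) ⟩
    fromℕ (t !) * (inv (t !) * inv (binomProd t))       ≡⟨ ℚP.*-assoc (fromℕ (t !)) (inv (t !)) (inv (binomProd t)) ⟨
    (fromℕ (t !) * inv (t !)) * inv (binomProd t)       ≡⟨ cong (_* inv (binomProd t)) (fromℕ-inverseˡ (ℕP.1≤n! t)) ⟩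
    1ℚ * inv (binomProd t)                              ≡⟨ ℚP.*-identityˡ (inv (binomProd t)) ⟩
    inv (binomProd t)                                   ∎

*-if : ∀ b x w → x * (if b then w else 0ℚ) ≡ w * (if b then x else 0ℚ)
*-if true  x w = ℚP.*-comm x w
*-if false x w = trans (ℚP.*-zeroʳ x) (sym (ℚP.*-zeroʳ w))

autCount*likelihood : ∀ n (G : SimpleGraph (suc n)) →
  fromℕ (autCount G) * likelihood G ≡ ∑ (perms (suc n)) (λ σ → exactProb (relabel (adj G) σ))
autCount*likelihood n G = begin
  a * likelihood G
    ≡⟨ cong (a *_) (sumℚ-map (process n) (λ { (H , w) → if isomorphic H (adj G) then w else 0ℚ })) ⟩
  a * ∑ (process n) (λ p → if isomorphic (proj₁ p) (adj G) then proj₂ p else 0ℚ)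
    ≡⟨ ∑-*ˡ (process n) a (λ p → if isomorphic (proj₁ p) (adj G) then proj₂ p else 0ℚ) ⟨
  ∑ (process n) (λ p → a * (if isomorphic (proj₁ p) (adj G) then proj₂ p else 0ℚ))
    ≡⟨ ∑-cong (process n) (λ p → *-if (isomorphic (proj₁ p) (adj G)) a (proj₂ p)) ⟩
  ∑ (process n) (λ p → proj₂ p * (if isomorphic (proj₁ p) (adj G) then a else 0ℚ))
    ≡⟨ ∑-cong (process n) (λ p → cong (proj₂ p *_) (∑-isIsoVia (proj₁ p) (adj G))) ⟨
  ∑ (process n) (λ p → proj₂ p * ∑ (perms (suc n)) (λ σ → ⟦ isIsoVia (proj₁ p) (adj G) σ ⟧))
    ≡⟨ ∑-cong (process n) (λ p → ∑-*ˡ (perms (suc n)) (proj₂ p) (λ σ → ⟦ isIsoVia (proj₁ p) (adj G) σ ⟧)) ⟨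
  ∑ (process n) (λ p → ∑ (perms (suc n)) (λ σ → proj₂ p * ⟦ isIsoVia (proj₁ p) (adj G) σ ⟧))
    ≡⟨ ∑-swap (process n) (perms (suc n)) (λ p σ → proj₂ p * ⟦ isIsoVia (proj₁ p) (adj G) σ ⟧) ⟩
  ∑ (perms (suc n)) (λ σ → exactProb (relabel (adj G) σ))
    ∎
  where
  open ≡-Reasoning
  a : ℚ
  a = fromℕ (autCount G)

divide-bounds : ∀ a b L → 1 ℕ.≤ b → inv b ≤ fromℕ a * L → fromℕ a * L ≤ 1ℚ →
                (inv (a ℕ.* b) ≤ L) × (L ≤ inv a)
-- a = 0 contradicts the lower bound, so the junk value inv 0 = 0 never enters.
divide-bounds zero (suc b) L _ lower _ = ⊥-elim (ℚP.<-irrefl refl (ℚP.<-≤-trans 0<inv lower′))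
  where
  0<inv : 0ℚ ℚ.< inv (suc b)
  0<inv = ℚP.positive⁻¹ (inv (suc b)) {{ℚP.normalize-pos 1 (suc b)}}
  lower′ : inv (suc b) ≤ 0ℚ
  lower′ = subst (inv (suc b) ≤_) (ℚP.*-zeroˡ L) lower
divide-bounds (suc a) b L _ lower upper =
    subst₂ _≤_ (sym (inv-* (suc a) b)) (sym L≡) (ℚP.*-monoˡ-≤-nonNeg (inv (suc a)) lower)
  , subst₂ _≤_ (sym L≡) (ℚP.*-identityʳ _) (ℚP.*-monoˡ-≤-nonNeg (inv (suc a)) upper)
  where
  instance
    inv-nonNegative : ℚ.NonNegative (inv (suc a))
    inv-nonNegative = ℚ.nonNegative (inv-nonNeg (suc a))
  L≡ : L ≡ inv (suc a) * (fromℕ (suc a) * L)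
  L≡ = sym (trans (sym (ℚP.*-assoc (inv (suc a)) (fromℕ (suc a)) L))
                  (trans (cong (_* L) (inv-inverseˡ a)) (ℚP.*-identityˡ L)))

mainTheorem8 : (n : ℕ) (G : SimpleGraph (suc n)) →
    (inv (autCount G ℕ.* binomProd (suc n)) ≤ likelihood G)
    × (likelihood G ≤ inv (autCount G))
mainTheorem8 n G =
  divide-bounds (autCount G) (binomProd (suc n)) (likelihood G) (binomProd-pos (suc n))
    (subst (inv (binomProd (suc n)) ≤_) (sym scaled) (proj₁ bounds))
    (subst (_≤ 1ℚ) (sym scaled) (proj₂ bounds))
  where
  relabelled-sum : ℚ
  relabelled-sum = ∑ (perms (suc n)) (λ σ → exactProb (relabel (adj G) σ))
  scaled : fromℕ (autCount G) * likelihood G ≡ relabelled-sum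
  scaled = autCount*likelihood n G
  bounds : (inv (binomProd (suc n)) ≤ relabelled-sum) × (relabelled-sum ≤ 1ℚ)
  bounds = ∑-exactProb-relabel-bounds n G
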